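{- Exact identification of monotone threshold functions of $n$ variables, using membership and subcube identity queries, requires at least $\binom{n}{\lfloor n/2\rfloor}$ queries in the worst case.
   Context: A threshold function of $x_1,\ldots,x_n$ is a Boolean function $f$ such that for some reals $\alpha_0,\alpha_1,\ldots,\alpha_n$, $f(x)=1\iff \alpha_1x_1+\cdots+\alpha_nx_n\ge\alpha_0$; it is a monotone threshold function if such weights exist with $\alpha_1,\ldots,\alpha_n\ge0$. A partial assignment $p$ is a map $\{x_1,\ldots,x_n\}\to\{0,1,*\}$; the projection $f_p$ is the function of the variables $p^{ -1}(*)$ obtained by fixing the others to their values under $p$. A membership query takes a total assignment $a$ and returns $f(a)$; a subcube identity query takes a partial assignment $p$ and returns "yes" iff $f_p\equiv0$ or $f_p\equiv1$. Exact identification: a deterministic algorithm, knowing the class and the variables, adaptively queries the unknown target and must determine it; the bound concerns the worst-case number of queries. -}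

module Defs where

open import Data.Bool using (Bool; true; false; not; if_then_else_)
open import Data.Nat using (ℕ; zero; suc; _+_)
open import Data.Fin using (Fin)
open import Data.Maybe using (Maybe; just; nothing; fromMaybe)
open import Data.List using (List; []; _∷_; map; concatMap)
open import Data.Bool.ListAction using (all)
open import Data.Vec.Functional using (Vector; foldr) renaming (_∷_ to _◂_)
open import Data.Rational using (ℚ; 0ℚ; 1ℚ; _≤_) renaming (_+_ to _+ℚ_; _*_ to _*ℚ_)
open import Data.Product using (Σ; _×_)
open import Relation.Binary.PropositionalEquality using (_≡_)

Assignment : ℕ → Set
Assignment n = Fin n → Bool

BoolFn : ℕ → Set
BoolFn n = Assignment n → Bool

⟦_⟧ : Bool → ℚ
⟦ true ⟧ = 1ℚ
⟦ false ⟧ = 0ℚ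

weightedSum : ∀ {n} → (Fin n → ℚ) → Assignment n → ℚ
weightedSum α a = foldr _+ℚ_ 0ℚ (λ i → α i *ℚ ⟦ a i ⟧)

IsMonotoneThreshold : ∀ {n} → BoolFn n → Set
IsMonotoneThreshold {n} f =
  Σ ℚ λ α₀ → Σ (Fin n → ℚ) λ α →
    (∀ i → 0ℚ ≤ α i) ×
    (∀ a → (f a ≡ true → α₀ ≤ weightedSum α a) × (α₀ ≤ weightedSum α a → f a ≡ true))

-- Partial assignment: nothing = *
PartialAssignment : ℕ → Set
PartialAssignment n = Fin n → Maybe Bool

allAssignments : (n : ℕ) → List (Assignment n)
allAssignments zero = (λ ()) ∷ []
allAssignments (suc n) =
  concatMap (λ a → (false ◂ a) ∷ (true ◂ a) ∷ []) (allAssignments n)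

extend : ∀ {n} → PartialAssignment n → Assignment n → Assignment n
extend p b i = fromMaybe (b i) (p i)

-- The projection f_p (as a function of all n variables, ignoring the fixed ones).
projection : ∀ {n} → BoolFn n → PartialAssignment n → BoolFn n
projection f p b = f (extend p b)

subcubeIdentity : ∀ {n} → BoolFn n → PartialAssignment n → Bool
subcubeIdentity {n} f p =
  if all (projection f p) (allAssignments n) then true
  else all (λ b → not (projection f p b)) (allAssignments n)

data Query (n : ℕ) : Set where
  membership : Assignment n → Query n
  subcube    : PartialAssignment n → Query n

answer : ∀ {n} → BoolFn n → Query n → Bool
answer f (membership a) = f a
answer f (subcube p)    = subcubeIdentity f p

-- A deterministic adaptive algorithm = decision tree: internal nodes ask a query and
-- branch on the (Boolean) answer; leaves output the hypothesis.
data Algorithm (n : ℕ) : Set where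
  output : BoolFn n → Algorithm n
  ask    : Query n → (ifYes ifNo : Algorithm n) → Algorithm n

run : ∀ {n} → Algorithm n → BoolFn n → BoolFn n
run (output h) f = h
run (ask q t e) f = if answer f q then run t f else run e f

queries : ∀ {n} → Algorithm n → BoolFn n → ℕ
queries (output h) f = zero
queries (ask q t e) f = suc (if answer f q then queries t f else queries e f)

Identifies : ∀ {n} → Algorithm n → Set
Identifies {n} A = ∀ (f : BoolFn n) → IsMonotoneThreshold f → ∀ a → run A f a ≡ f a

-- Let k = ⌊n/2⌋ and let f be the threshold function "more than k ones". For each
-- k-subset S, the function f_S = f ∨ [x = S] is again a monotone threshold function
-- (weights k + [i ∈ S], threshold k(k+1)). A membership query distinguishes f from f_S
-- only at x = S, and a subcube query, on monotone functions, only sees the two corners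
-- of the subcube, which (being comparable) single out at most one S. So every query answered as for f
-- rules out at most one of the (n choose k) functions f_S, and an algorithm making
-- fewer queries on f is fooled by some f_S.
module Submission where

open import Defs
open import Data.Nat using (ℕ; _≤_; _/_)
open import Data.Nat.Combinatorics using (_C_)
open import Data.Product using (Σ; _×_)

open import Data.Bool using (Bool; true; false; not; _∧_; _xor_; if_then_else_)
import Data.Bool.Properties as Bool
open import Data.Bool.ListAction using (all)
open import Data.Empty using (⊥)
open import Data.Fin using (Fin; zero; suc)
open import Data.Integer as ℤ using (+_; +≤+)
import Data.Integer.Properties as ℤ
open import Data.List using (List; []; _∷_; map; length; filter; _++_)
import Data.List.Properties as List
open import Data.List.Membership.Propositional using (_∈_; _∉_)
import Data.List.Membership.Propositional.Properties as Membership
open import Data.List.Relation.Unary.All as All using (All; []; _∷_)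
import Data.List.Relation.Unary.All.Properties as All
open import Data.List.Relation.Unary.AllPairs using ([]; _∷_)
open import Data.List.Relation.Unary.Any as Any using (Any; here; there)
open import Data.List.Relation.Unary.Any.Properties using (concatMap⁺)
open import Data.List.Relation.Unary.Unique.Propositional using (Unique)
import Data.List.Relation.Unary.Unique.Propositional.Properties as Unique
open import Data.Maybe using (just; nothing; fromMaybe)
open import Data.Nat as ℕ using (_+_; _*_; _<_; _≤ᵇ_; z≤n; _<?_; _≟_)
open import Data.Nat.Combinatorics using (nCk+nC[k+1]≡[n+1]C[k+1])
import Data.Nat.Coprimality as Coprimality
open import Data.Nat.Properties
open import Data.Product using (_,_; ∃-syntax)
open import Data.Rational using (ℚ; mkℚ; *≤*) renaming (_+_ to _+ℚ_; _*_ to _*ℚ_; _≤_ to _≤ℚ_)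
import Data.Rational.Properties as ℚ
import Data.Rational.Unnormalised as ℚᵘ
import Data.Rational.Unnormalised.Properties as ℚᵘ
open import Data.Vec using (Vec; lookup; tabulate) renaming ([] to []ᵥ; _∷_ to _∷ᵥ_)
import Data.Vec.Properties as Vec
open import Data.Vec.Functional using () renaming (_∷_ to _◂_)
open import Function using (_∘_; Equivalence)
open import Relation.Binary.Definitions using (DecidableEquality)
open import Relation.Binary.PropositionalEquality
open import Relation.Nullary using (¬_; yes; no; ¬?; contradiction)

open import Algebra.Properties.Semiring.Sum +-*-semiring
  using (sum; sum-cong-≗; ∑-distrib-+; *-distribˡ-sum)

private
  variable
    n k : ℕ

-- Threshold functions with natural weights

bit : Bool → ℕ
bit b = if b then 1 else 0

weightOf : (Fin n → ℕ) → Assignment n → ℕ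
weightOf w a = sum (λ i → if a i then w i else 0)

ones : Assignment n → ℕ
ones = weightOf (λ _ → 1)

-- Opaque so that `threshold t w a` stays rigid in unification: weightOf is not injective.
opaque
  threshold : ℕ → (Fin n → ℕ) → BoolFn n
  threshold t w a = t ≤ᵇ weightOf w a

  threshold⁺ : ∀ {t} {w : Fin n → ℕ} {a} → t ≤ weightOf w a → threshold t w a ≡ true
  threshold⁺ t≤ = Equivalence.to Bool.T-≡ (≤⇒≤ᵇ t≤)

  threshold⁻ : ∀ {t} {w : Fin n → ℕ} {a} → threshold t w a ≡ true → t ≤ weightOf w a
  threshold⁻ {t = t} {w} {a} e = ≤ᵇ⇒≤ t (weightOf w a) (Equivalence.from Bool.T-≡ e)

threshold-false : ∀ {t} {w : Fin n → ℕ} {a} → weightOf w a < t → threshold t w a ≡ false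
threshold-false <t = Bool.¬-not (λ e → <⇒≱ <t (threshold⁻ e))

fromℕ : ℕ → ℚ
fromℕ m = mkℚ (+ m) 0 (Coprimality.sym (Coprimality.1-coprimeTo m))

fromℕ-+ : ∀ m m′ → fromℕ m +ℚ fromℕ m′ ≡ fromℕ (m + m′)
fromℕ-+ m m′ = ℚ.toℚᵘ-injective
  (ℚᵘ.≃-trans (ℚ.toℚᵘ-homo-+ (fromℕ m) (fromℕ m′)) (ℚᵘ.*≡* crossProducts))
  where
  crossProducts : (+ m ℤ.* + 1 ℤ.+ + m′ ℤ.* + 1) ℤ.* + 1 ≡ + (m + m′) ℤ.* + 1
  crossProducts rewrite ℤ.*-identityʳ (+ m) | ℤ.*-identityʳ (+ m′) | ℤ.*-identityʳ (+ (m + m′)) = refl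

fromℕ-mono-≤ : ∀ {m m′} → m ≤ m′ → fromℕ m ≤ℚ fromℕ m′
fromℕ-mono-≤ {m} {m′} le =
  *≤* (subst₂ ℤ._≤_ (sym (ℤ.*-identityʳ (+ m))) (sym (ℤ.*-identityʳ (+ m′))) (+≤+ le))

fromℕ-cancel-≤ : ∀ {m m′} → fromℕ m ≤ℚ fromℕ m′ → m ≤ m′
fromℕ-cancel-≤ {m} {m′} (*≤* le)
  with +≤+ le′ ← subst₂ ℤ._≤_ (ℤ.*-identityʳ (+ m)) (ℤ.*-identityʳ (+ m′)) le = le′

weightedSum-fromℕ : (w : Fin n → ℕ) (a : Assignment n) →
                    weightedSum (fromℕ ∘ w) a ≡ fromℕ (weightOf w a)
weightedSum-fromℕ {ℕ.zero} w a = refl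
weightedSum-fromℕ {ℕ.suc n} w a =
  trans (cong₂ _+ℚ_ (term (a zero)) (weightedSum-fromℕ (w ∘ suc) (a ∘ suc)))
        (fromℕ-+ _ (weightOf (w ∘ suc) (a ∘ suc)))
  where
  term : ∀ b → fromℕ (w zero) *ℚ ⟦ b ⟧ ≡ fromℕ (if b then w zero else 0)
  term true  = ℚ.*-identityʳ (fromℕ (w zero))
  term false = ℚ.*-zeroʳ (fromℕ (w zero))

threshold-isMonotoneThreshold : ∀ t (w : Fin n → ℕ) → IsMonotoneThreshold (threshold t w)
threshold-isMonotoneThreshold t w =
  fromℕ t , fromℕ ∘ w , (λ _ → fromℕ-mono-≤ z≤n) , λ a →
    (λ e → subst (fromℕ t ≤ℚ_) (sym (weightedSum-fromℕ w a)) (fromℕ-mono-≤ (threshold⁻ e))) ,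
    (λ le → threshold⁺ (fromℕ-cancel-≤ (subst (fromℕ t ≤ℚ_) (weightedSum-fromℕ w a) le)))

_⊑_ : Assignment n → Assignment n → Set
a ⊑ b = ∀ i → a i ≡ true → b i ≡ true

Monotone : BoolFn n → Set
Monotone f = ∀ {a b} → a ⊑ b → f a ≡ true → f b ≡ true

≗⇒⊑ : {a b : Assignment n} → a ≗ b → a ⊑ b
≗⇒⊑ a≗b i = trans (sym (a≗b i))

monotone-cong : {f : BoolFn n} → Monotone f → ∀ {a b} → a ≗ b → f a ≡ f b
monotone-cong {f = f} mono {a} {b} a≗b with f a in fa | f b in fb
... | true  | true  = refl
... | false | false = refl
... | true  | false = trans (sym (mono (≗⇒⊑ a≗b) fa)) fb
... | false | true  = trans (sym fa) (mono (≗⇒⊑ (sym ∘ a≗b)) fb)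

weightOf-mono : (w : Fin n → ℕ) {a b : Assignment n} → a ⊑ b → weightOf w a ≤ weightOf w b
weightOf-mono {ℕ.zero} w a⊑b = z≤n
weightOf-mono {ℕ.suc n} w {a} {b} a⊑b =
  +-mono-≤ (term (a zero) (b zero) (a⊑b zero)) (weightOf-mono (w ∘ suc) (a⊑b ∘ suc))
  where
  term : ∀ x y → (x ≡ true → y ≡ true) → (if x then w zero else 0) ≤ (if y then w zero else 0)
  term false y x⇒y = z≤n
  term true  y x⇒y rewrite x⇒y refl = ≤-refl

threshold-monotone : ∀ t (w : Fin n → ℕ) → Monotone (threshold t w)
threshold-monotone t w a⊑b e = threshold⁺ (≤-trans (threshold⁻ e) (weightOf-mono w a⊑b))

bit-injective : ∀ {x y} → bit x ≡ bit y → x ≡ y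
bit-injective {false} {false} _ = refl
bit-injective {true}  {true}  _ = refl

bit-mono : ∀ {x y} → (x ≡ true → y ≡ true) → bit x ≤ bit y
bit-mono {false} x⇒y = z≤n
bit-mono {true}  x⇒y rewrite x⇒y refl = ≤-refl

⊑∧ones≤⇒≗ : {a b : Assignment n} → a ⊑ b → ones b ≤ ones a → a ≗ b
⊑∧ones≤⇒≗ {ℕ.suc n} {a} {b} a⊑b ones≤ = λ
  { zero    → bit-injective (≤-antisym (bit-mono (a⊑b zero)) head≤)
  ; (suc i) → ⊑∧ones≤⇒≗ (a⊑b ∘ suc) tail≤ i }
  where
  head≤ : bit (b zero) ≤ bit (a zero)
  head≤ = +-cancelʳ-≤ (ones (b ∘ suc)) _ _
    (≤-trans ones≤ (+-monoʳ-≤ (bit (a zero)) (weightOf-mono (λ _ → 1) (a⊑b ∘ suc))))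
  tail≤ : ones (b ∘ suc) ≤ ones (a ∘ suc)
  tail≤ = +-cancelˡ-≤ (bit (b zero)) _ _
    (≤-trans ones≤ (+-monoˡ-≤ (ones (a ∘ suc)) (bit-mono (a⊑b zero))))

-- Subcube queries on monotone functions

lowest highest : PartialAssignment n → Assignment n
lowest  p = extend p (λ _ → false)
highest p = extend p (λ _ → true)

extend-mono : (p : PartialAssignment n) {a b : Assignment n} → a ⊑ b → extend p a ⊑ extend p b
extend-mono p a⊑b i with p i
... | just _  = λ e → e
... | nothing = a⊑b i

extend-cong : (p : PartialAssignment n) {a b : Assignment n} → a ≗ b → extend p a ≗ extend p b
extend-cong p a≗b i = cong (λ x → fromMaybe x (p i)) (a≗b i)

lowest⊑extend : (p : PartialAssignment n) (b : Assignment n) → lowest p ⊑ extend p b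
lowest⊑extend p b = extend-mono p (λ _ ())

extend⊑highest : (p : PartialAssignment n) (b : Assignment n) → extend p b ⊑ highest p
extend⊑highest p b = extend-mono p (λ _ _ → refl)

allAssignments-complete : (b : Assignment n) → Any (_≗ b) (allAssignments n)
allAssignments-complete {ℕ.zero} b = here (λ ())
allAssignments-complete {ℕ.suc n} b =
  concatMap⁺ (λ a → (false ◂ a) ∷ (true ◂ a) ∷ []) (Any.map cons (allAssignments-complete (b ∘ suc)))
  where
  cons : ∀ {a} → a ≗ b ∘ suc → Any (_≗ b) ((false ◂ a) ∷ (true ◂ a) ∷ [])
  cons a≗ with b zero in b₀
  ... | false = here λ { zero → sym b₀ ; (suc i) → a≗ i }
  ... | true  = there (here λ { zero → sym b₀ ; (suc i) → a≗ i })

all-true : ∀ {A : Set} {P : A → Bool} → (∀ x → P x ≡ true) → ∀ xs → all P xs ≡ true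
all-true P≡ []       = refl
all-true P≡ (x ∷ xs) = cong₂ _∧_ (P≡ x) (all-true P≡ xs)

all-false : ∀ {A : Set} {P : A → Bool} {xs} → Any (λ x → P x ≡ false) xs → all P xs ≡ false
all-false (here Px)                      rewrite Px = refl
all-false {P = P} {x ∷ _} (there Pxs) rewrite all-false Pxs = Bool.∧-zeroʳ (P x)

all-false-allAssignments : {P : Assignment n → Bool} → (∀ {a b} → a ≗ b → P a ≡ P b) →
                           ∀ b → P b ≡ false → all P (allAssignments n) ≡ false
all-false-allAssignments P-cong b Pb =
  all-false (Any.map (λ a≗b → trans (P-cong a≗b) Pb) (allAssignments-complete b))

projection-cong : {f : BoolFn n} → Monotone f → (p : PartialAssignment n) →
                  ∀ {a b} → a ≗ b → projection f p a ≡ projection f p b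
projection-cong mono p a≗b = monotone-cong mono (extend-cong p a≗b)

subcubeIdentity-monotone : {f : BoolFn n} → Monotone f → (p : PartialAssignment n) →
                           subcubeIdentity f p ≡ not (f (lowest p) xor f (highest p))
subcubeIdentity-monotone {n} {f} mono p with f (lowest p) in fL | f (highest p) in fH
... | true | true
  rewrite all-true (λ b → mono (lowest⊑extend p b) fL) (allAssignments n) = refl
... | true | false = contradiction (trans (sym (mono (lowest⊑extend p _) fL)) fH) λ ()
... | false | false
  rewrite all-false-allAssignments (projection-cong mono p) (λ _ → false) fL
  = all-true (λ b → cong not (below-highest b)) (allAssignments n)
  where
  below-highest : ∀ b → f (extend p b) ≡ false
  below-highest b = Bool.¬-not λ fb → contradiction (trans (sym fH) (mono (extend⊑highest p b) fb)) λ ()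
... | false | true
  rewrite all-false-allAssignments (projection-cong mono p) (λ _ → false) fL
  = all-false-allAssignments (cong not ∘ projection-cong mono p) (λ _ → true) (cong not fH)

subcubeIdentity-corners : {f g : BoolFn n} → Monotone f → Monotone g → (p : PartialAssignment n) →
                          f (lowest p) ≡ g (lowest p) → f (highest p) ≡ g (highest p) →
                          subcubeIdentity f p ≡ subcubeIdentity g p
subcubeIdentity-corners {f = f} {g} f-mono g-mono p fL≡gL fH≡gH = begin
  subcubeIdentity f p                     ≡⟨ subcubeIdentity-monotone f-mono p ⟩
  not (f (lowest p) xor f (highest p))   ≡⟨ cong₂ (λ x y → not (x xor y)) fL≡gL fH≡gH ⟩
  not (g (lowest p) xor g (highest p))   ≡⟨ subcubeIdentity-monotone g-mono p ⟨
  subcubeIdentity g p                     ∎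
  where open ≡-Reasoning

-- The hard function and its fooling functions

moreThan : ℕ → BoolFn n
moreThan k = threshold (ℕ.suc k) (λ _ → 1)

-- For ones S ≡ k this accepts exactly what moreThan k accepts, and S itself.
moreThanOr : ℕ → Assignment n → BoolFn n
moreThanOr k S = threshold (k * ℕ.suc k) (λ i → k + bit (S i))

weightOf-moreThanOr : ∀ k (S a : Assignment n) →
                      weightOf (λ i → k + bit (S i)) a ≡ k * ones a + ones (λ i → S i ∧ a i)
weightOf-moreThanOr k S a = begin
  weightOf (λ i → k + bit (S i)) a
    ≡⟨ sum-cong-≗ (λ i → split (S i) (a i)) ⟩
  sum (λ i → k * bit (a i) + bit (S i ∧ a i))
    ≡⟨ ∑-distrib-+ (λ i → k * bit (a i)) (λ i → bit (S i ∧ a i)) ⟩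
  sum (λ i → k * bit (a i)) + ones (λ i → S i ∧ a i)
    ≡⟨ cong (_+ ones (λ i → S i ∧ a i)) (*-distribˡ-sum k (bit ∘ a)) ⟨
  k * ones a + ones (λ i → S i ∧ a i) ∎
  where
  open ≡-Reasoning
  split : ∀ x y → (if y then k + bit x else 0) ≡ k * bit y + bit (x ∧ y)
  split x false = cong₂ _+_ (sym (*-zeroʳ k)) (cong bit (sym (Bool.∧-zeroʳ x)))
  split x true  = cong₂ _+_ (sym (*-identityʳ k)) (cong bit (sym (Bool.∧-identityʳ x)))

ones≤ones-∧⇒⊑ : {S a : Assignment n} → ones S ≤ ones (λ i → S i ∧ a i) → S ⊑ a
ones≤ones-∧⇒⊑ {S = S} {a} ones≤ i Sᵢ = ∧-true-right (S i) (trans (S∧a≗S i) Sᵢ)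
  where
  ∧-true-right : ∀ x {y} → x ∧ y ≡ true → y ≡ true
  ∧-true-right true e = e
  ∧-⊑ˡ : (λ i → S i ∧ a i) ⊑ S
  ∧-⊑ˡ i e with S i
  ... | true = refl
  ... | false = e
  S∧a≗S : (λ i → S i ∧ a i) ≗ S
  S∧a≗S = ⊑∧ones≤⇒≗ ∧-⊑ˡ ones≤

moreThan-true : {a : Assignment n} → k < ones a → moreThan k a ≡ true
moreThan-true = threshold⁺

moreThan-false : {a : Assignment n} → ones a ≤ k → moreThan k a ≡ false
moreThan-false a≤k = threshold-false (ℕ.s≤s a≤k)

moreThanOr-self : {S : Assignment n} → ones S ≡ k → moreThanOr k S S ≡ true
moreThanOr-self {k = k} {S} refl = threshold⁺ (≤-reflexive (begin
  k * ℕ.suc k                             ≡⟨ *-suc k k ⟩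
  k + k * k                               ≡⟨ +-comm k (k * k) ⟩
  k * k + k                               ≡⟨ cong (_+_ (k * k)) (sum-cong-≗ (λ i → cong bit (Bool.∧-idem (S i)))) ⟨
  k * ones S + ones (λ i → S i ∧ S i)     ≡⟨ weightOf-moreThanOr k S S ⟨
  weightOf (λ i → k + bit (S i)) S        ∎))
  where open ≡-Reasoning

-- Below k + 1 ones, the weight k · ones a + |S ∩ a| reaches k(k + 1) only if S ⊆ a.
moreThanOr-below⇒≗ : {S a : Assignment n} → ones S ≡ k →
                     moreThanOr k S a ≡ true → ones a ≤ k → S ≗ a
moreThanOr-below⇒≗ {k = k} {S} {a} refl accepted a≤k =
  ⊑∧ones≤⇒≗ (ones≤ones-∧⇒⊑ (+-cancelˡ-≤ (k * k) k shared weight-bound)) a≤k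
  where
  shared : ℕ
  shared = ones (λ i → S i ∧ a i)
  weight-bound : k * k + k ≤ k * k + shared
  weight-bound = begin
    k * k + k                         ≡⟨ +-comm (k * k) k ⟩
    k + k * k                         ≡⟨ *-suc k k ⟨
    k * ℕ.suc k                       ≤⟨ threshold⁻ accepted ⟩
    weightOf (λ i → k + bit (S i)) a  ≡⟨ weightOf-moreThanOr k S a ⟩
    k * ones a + shared               ≤⟨ +-monoˡ-≤ shared (*-monoʳ-≤ k a≤k) ⟩
    k * k + shared                    ∎
    where open ≤-Reasoning

moreThanOr-agrees : {S a : Assignment n} → ones S ≡ k → ¬ S ≗ a → moreThanOr k S a ≡ moreThan k a
moreThanOr-agrees {k = k} {S} {a} S-size S≉a with k <? ones a
... | yes k<a = trans (threshold⁺ (begin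
    k * ℕ.suc k                          ≤⟨ *-monoʳ-≤ k k<a ⟩
    k * ones a                           ≤⟨ m≤m+n (k * ones a) _ ⟩
    k * ones a + ones (λ i → S i ∧ a i)  ≡⟨ weightOf-moreThanOr k S a ⟨
    weightOf (λ i → k + bit (S i)) a     ∎))
  (sym (moreThan-true k<a))
  where open ≤-Reasoning
... | no k≮a = trans
  (Bool.¬-not (λ accepted → S≉a (moreThanOr-below⇒≗ S-size accepted a≤k)))
  (sym (moreThan-false a≤k))
  where a≤k = ≮⇒≥ k≮a

-- The only k-subset S for which moreThanOr k S may answer q differently from moreThan k.

candidate : ℕ → Query n → Vec Bool n
candidate k (membership a) = tabulate a
candidate k (subcube p) with ones (highest p) ≟ k
... | yes _ = tabulate (highest p)
... | no  _ = tabulate (lowest p)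

lookup≗⇒≡tabulate : {S : Vec Bool n} {a : Assignment n} → lookup S ≗ a → S ≡ tabulate a
lookup≗⇒≡tabulate {S = S} S≗a = trans (sym (Vec.tabulate∘lookup S)) (Vec.tabulate-cong S≗a)

ones-cong : {a b : Assignment n} → a ≗ b → ones a ≡ ones b
ones-cong a≗b = sum-cong-≗ (cong bit ∘ a≗b)

subcube-moreThanOr : {S : Assignment n} → ones S ≡ k → (p : PartialAssignment n) →
                     ¬ S ≗ lowest p → ¬ S ≗ highest p →
                     subcubeIdentity (moreThanOr k S) p ≡ subcubeIdentity (moreThan k) p
subcube-moreThanOr S-size p S≉L S≉H =
  subcubeIdentity-corners (threshold-monotone _ _) (threshold-monotone _ _) p
    (moreThanOr-agrees S-size S≉L) (moreThanOr-agrees S-size S≉H)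

answer-moreThanOr : {S : Vec Bool n} → ones (lookup S) ≡ k → ∀ q → S ≢ candidate k q →
                    answer (moreThanOr k (lookup S)) q ≡ answer (moreThan k) q
answer-moreThanOr S-size (membership a) S≢a = moreThanOr-agrees S-size (S≢a ∘ lookup≗⇒≡tabulate)
answer-moreThanOr {k = k} {S} S-size (subcube p) S≢c with ones (highest p) ≟ k
... | yes highest-size = subcube-moreThanOr S-size p S≉L S≉H
  where
  S≉H : ¬ lookup S ≗ highest p
  S≉H = S≢c ∘ lookup≗⇒≡tabulate
  -- lowest p ⊑ highest p, so if both had k ones they would be equal
  S≉L : ¬ lookup S ≗ lowest p
  S≉L S≗L = S≉H λ i → trans (S≗L i) (⊑∧ones≤⇒≗ (extend⊑highest p (λ _ → false))
    (≤-reflexive (trans highest-size (sym (trans (ones-cong (sym ∘ S≗L)) S-size)))) i)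
... | no highest-size = subcube-moreThanOr S-size p (S≢c ∘ lookup≗⇒≡tabulate)
  (λ S≗H → highest-size (trans (ones-cong (sym ∘ S≗H)) S-size))

queriesAlong : Algorithm n → BoolFn n → List (Query n)
queriesAlong (output _)  f = []
queriesAlong (ask q t e) f = q ∷ (if answer f q then queriesAlong t f else queriesAlong e f)

length-queriesAlong : (A : Algorithm n) (f : BoolFn n) → length (queriesAlong A f) ≡ queries A f
length-queriesAlong (output _)  f = refl
length-queriesAlong (ask q t e) f with answer f q
... | true  = cong ℕ.suc (length-queriesAlong t f)
... | false = cong ℕ.suc (length-queriesAlong e f)

run-cong : (A : Algorithm n) {f g : BoolFn n} →
           All (λ q → answer g q ≡ answer f q) (queriesAlong A f) → run A g ≡ run A f
run-cong (output _)   _             = refl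
run-cong (ask q t e) {f} (same ∷ rest) rewrite same with answer f q
... | true  = run-cong t rest
... | false = run-cong e rest

module _ {A : Set} (_≟ᴬ_ : DecidableEquality A) where
  open import Data.List.Membership.DecPropositional _≟ᴬ_ using (_∈?_)

  unique-length<⇒∃∉ : {xs ys : List A} → Unique xs → length ys < length xs → ∃[ x ] x ∈ xs × x ∉ ys
  unique-length<⇒∃∉ {x ∷ xs} {ys} (x∉xs ∷ xs!) ys< with x ∈? ys
  ... | no x∉ys = x , here refl , x∉ys
  ... | yes x∈ys = fromRest (unique-length<⇒∃∉ xs! (<-≤-trans rest<ys (≤-pred ys<)))
    where
    ≢x? = λ z → ¬? (z ≟ᴬ x)
    rest<ys : length (filter ≢x? ys) < length ys
    rest<ys = List.filter-notAll ≢x? ys (Any.map (λ x≡z z≢x → z≢x (sym x≡z)) x∈ys)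
    fromRest : ∃[ y ] y ∈ xs × y ∉ filter ≢x? ys → ∃[ y ] y ∈ x ∷ xs × y ∉ ys
    fromRest (y , y∈xs , y∉rest) =
      y , there y∈xs , λ y∈ys → y∉rest (Membership.∈-filter⁺ ≢x? y∈ys (All.lookup x∉xs y∈xs ∘ sym))

subsetsOfSize : (n k : ℕ) → List (Vec Bool n)
subsetsOfSize ℕ.zero    ℕ.zero    = []ᵥ ∷ []
subsetsOfSize ℕ.zero    (ℕ.suc k) = []
subsetsOfSize (ℕ.suc n) ℕ.zero    = map (false ∷ᵥ_) (subsetsOfSize n ℕ.zero)
subsetsOfSize (ℕ.suc n) (ℕ.suc k) =
  map (false ∷ᵥ_) (subsetsOfSize n (ℕ.suc k)) ++ map (true ∷ᵥ_) (subsetsOfSize n k)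

length-subsetsOfSize : ∀ n k → length (subsetsOfSize n k) ≡ n C k
length-subsetsOfSize ℕ.zero    ℕ.zero    = refl
length-subsetsOfSize ℕ.zero    (ℕ.suc k) = refl
length-subsetsOfSize (ℕ.suc n) ℕ.zero    =
  trans (List.length-map _ (subsetsOfSize n ℕ.zero)) (length-subsetsOfSize n ℕ.zero)
length-subsetsOfSize (ℕ.suc n) (ℕ.suc k) = begin
  length (map (false ∷ᵥ_) (subsetsOfSize n (ℕ.suc k)) ++ map (true ∷ᵥ_) (subsetsOfSize n k))
    ≡⟨ List.length-++ (map (false ∷ᵥ_) (subsetsOfSize n (ℕ.suc k))) ⟩
  length (map (false ∷ᵥ_) (subsetsOfSize n (ℕ.suc k))) + length (map (true ∷ᵥ_) (subsetsOfSize n k))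
    ≡⟨ cong₂ _+_ (List.length-map _ (subsetsOfSize n (ℕ.suc k))) (List.length-map _ (subsetsOfSize n k)) ⟩
  length (subsetsOfSize n (ℕ.suc k)) + length (subsetsOfSize n k)
    ≡⟨ cong₂ _+_ (length-subsetsOfSize n (ℕ.suc k)) (length-subsetsOfSize n k) ⟩
  n C ℕ.suc k + n C k
    ≡⟨ +-comm (n C ℕ.suc k) (n C k) ⟩
  n C k + n C ℕ.suc k
    ≡⟨ nCk+nC[k+1]≡[n+1]C[k+1] n k ⟩
  ℕ.suc n C ℕ.suc k ∎
  where open ≡-Reasoning

subsetsOfSize-unique : ∀ n k → Unique (subsetsOfSize n k)
subsetsOfSize-unique ℕ.zero    ℕ.zero    = [] ∷ []
subsetsOfSize-unique ℕ.zero    (ℕ.suc k) = []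
subsetsOfSize-unique (ℕ.suc n) ℕ.zero    = Unique.map⁺ Vec.∷-injectiveʳ (subsetsOfSize-unique n ℕ.zero)
subsetsOfSize-unique (ℕ.suc n) (ℕ.suc k) = Unique.++⁺
  (Unique.map⁺ Vec.∷-injectiveʳ (subsetsOfSize-unique n (ℕ.suc k)))
  (Unique.map⁺ Vec.∷-injectiveʳ (subsetsOfSize-unique n k))
  heads-differ
  where
  heads-differ : ∀ {v} → ¬ (v ∈ map (false ∷ᵥ_) (subsetsOfSize n (ℕ.suc k)) ×
                            v ∈ map (true ∷ᵥ_) (subsetsOfSize n k))
  heads-differ (v∈₀ , v∈₁) with Membership.∈-map⁻ (false ∷ᵥ_) v∈₀ | Membership.∈-map⁻ (true ∷ᵥ_) v∈₁
  ... | _ , _ , refl | _ , _ , ()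

subsetsOfSize-ones : ∀ n k → All (λ S → ones (lookup S) ≡ k) (subsetsOfSize n k)
subsetsOfSize-ones ℕ.zero    ℕ.zero    = refl ∷ []
subsetsOfSize-ones ℕ.zero    (ℕ.suc k) = []
subsetsOfSize-ones (ℕ.suc n) ℕ.zero    = All.map⁺ (subsetsOfSize-ones n ℕ.zero)
subsetsOfSize-ones (ℕ.suc n) (ℕ.suc k) = All.++⁺
  (All.map⁺ (subsetsOfSize-ones n (ℕ.suc k)))
  (All.map⁺ (All.map (cong ℕ.suc) (subsetsOfSize-ones n k)))

fooled : {A : Algorithm n} → Identifies A → {S : Vec Bool n} → ones (lookup S) ≡ k →
         S ∉ map (candidate k) (queriesAlong A (moreThan k)) → ⊥
fooled {k = k} {A} identifies {S} S-size S∉ = contradiction (begin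
  true                                        ≡⟨ moreThanOr-self S-size ⟨
  moreThanOr k (lookup S) (lookup S)          ≡⟨ identifies _ (threshold-isMonotoneThreshold _ _) (lookup S) ⟨
  run A (moreThanOr k (lookup S)) (lookup S)  ≡⟨ cong-app (run-cong A same-answers) (lookup S) ⟩
  run A (moreThan k) (lookup S)               ≡⟨ identifies _ (threshold-isMonotoneThreshold _ _) (lookup S) ⟩
  moreThan k (lookup S)                       ≡⟨ moreThan-false (≤-reflexive S-size) ⟩
  false                                       ∎) λ ()
  where
  open ≡-Reasoning
  same-answers : All (λ q → answer (moreThanOr k (lookup S)) q ≡ answer (moreThan k) q)
                     (queriesAlong A (moreThan k))
  same-answers = All.tabulate λ {q} q∈ → answer-moreThanOr S-size q
    λ S≡c → S∉ (subst (_∈ _) (sym S≡c) (Membership.∈-map⁺ (candidate k) q∈))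

queries-lowerBound : {A : Algorithm n} → Identifies A → ∀ k → n C k ≤ queries A (moreThan k)
queries-lowerBound {n} {A} identifies k = ≮⇒≥ λ few →
  let S , S∈ , S∉ = unique-length<⇒∃∉ (Vec.≡-dec Bool._≟_) (subsetsOfSize-unique n k)
                      (subst₂ _<_ (sym candidates-length) (sym (length-subsetsOfSize n k)) few)
  in fooled {A = A} identifies (All.lookup (subsetsOfSize-ones n k) S∈) S∉
  where
  candidates-length : length (map (candidate k) (queriesAlong A (moreThan k))) ≡ queries A (moreThan k)
  candidates-length = trans (List.length-map (candidate k) (queriesAlong A (moreThan k)))
                            (length-queriesAlong A (moreThan k))

theorem3 : (n : ℕ) (A : Algorithm n) → Identifies A →
    Σ (BoolFn n) λ f → IsMonotoneThreshold f × (n C (n / 2)) ≤ queries A f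
theorem3 n A identifies =
  moreThan (n / 2) , threshold-isMonotoneThreshold _ _ , queries-lowerBound identifies (n / 2)
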